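{- Let $\mathbb F$ be a field and $n\ge4$ even. Define the linear map $\mathbf T'\colon\mathcal M_{n\,2}(\mathbb F)\to\mathcal M_{n\,2}(\mathbb F)$ by letting $\mathbf T'(X)$ coincide with $X=(x_{i\,j})$ except that its $(1,1)$ entry is $\sum_{i=2}^{n-1}(-1)^ix_{i\,1}+\sum_{i=2}^{n}(-1)^ix_{i\,2}$ and its $(n,2)$ entry is $\sum_{i=2}^{n-1}(-1)^{i-1}x_{i\,2}+\sum_{i=1}^{n-1}(-1)^{i-1}x_{i\,1}$. Then $\det_{n\,2}(\mathbf T'(X))=\det_{n\,2}(X)$ for all $X\in\mathcal M_{n\,2}(\mathbb F)$, and $\mathbf T'$ is not of the form $X\mapsto AXB+\phi(X)$ for any $A\in\mathcal M_{n\,n}(\mathbb F)$, $B\in\mathcal M_{2\,2}(\mathbb F)$ and any linear map $\phi$ from $\mathcal M_{n\,2}(\mathbb F)$ to the subspace $\{Z\in\mathcal M_{n\,2}(\mathbb F): \text{all rows of } Z \text{ are equal}\}$.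
   Context: $\mathcal M_{n\,k}(\mathbb F)$ denotes the $n\times k$ matrices over $\mathbb F$. For $Z=(z_{i\,j})\in\mathcal M_{n\,2}(\mathbb F)$ the Cullis determinant is $\det_{n\,2}(Z)=\sum_{1\le i<j\le n}(-1)^{i+j-3}(z_{i\,1}z_{j\,2}-z_{i\,2}z_{j\,1})$. -}

module Defs where

open import Level using (_⊔_; suc)
open import Algebra.Bundles using (CommutativeRing)
open import Data.Nat as ℕ using (ℕ; zero; _≤ᵇ_; _<ᵇ_)
open import Data.Fin using (Fin; toℕ)
open import Data.Bool using (Bool; true; false; if_then_else_; _∧_)
open import Data.Product using (∃)
open import Relation.Nullary using (¬_)

record Field (c ℓ : Level.Level) : Set (Level.suc (c ⊔ ℓ)) where
  field
    commutativeRing : CommutativeRing c ℓ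
  open CommutativeRing commutativeRing public
  field
    0≉1 : ¬ (0# ≈ 1#)
    inverse : ∀ x → ¬ (x ≈ 0#) → ∃ λ y → x * y ≈ 1#

module FieldDefs {c ℓ} (F : Field c ℓ) where
  open Field F
  open import Algebra.Definitions.RawMonoid +-rawMonoid using (sum)

  Mat : ℕ → ℕ → Set c
  Mat n k = Fin n → Fin k → Carrier

  sgn : ℕ → Carrier
  sgn zero = 1#
  sgn (ℕ.suc m) = - sgn m

  ix : ∀ {n} → Fin n → ℕ
  ix i = ℕ.suc (toℕ i)

  sumRange : ∀ n → ℕ → ℕ → (Fin n → Carrier) → Carrier
  sumRange n lo hi f = sum {n} (λ i → if (lo ≤ᵇ ix i) ∧ (ix i ≤ᵇ hi) then f i else 0#)

  c1 c2 : Fin 2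
  c1 = Fin.zero
  c2 = Fin.suc Fin.zero

  -- Cullis determinant det_{n2}:
  -- Σ_{1≤i<j≤n} (-1)^{i+j-3} (z_{i1} z_{j2} - z_{i2} z_{j1})
  -- note i + j ≥ 3, so (i + j) ∸ 3 is the true exponent.
  det₂ : ∀ {n} → Mat n 2 → Carrier
  det₂ {n} Z = sum {n} λ i → sum {n} λ j →
    if ix i <ᵇ ix j
      then sgn ((ix i ℕ.+ ix j) ℕ.∸ 3) * (Z i c1 * Z j c2 - Z i c2 * Z j c1)
      else 0#

  T′ : ∀ {n} → Mat n 2 → Mat n 2
  T′ {n} X i j =
    if (ix i ℕ.≡ᵇ 1) ∧ (toℕ j ℕ.≡ᵇ 0) then
      sumRange n 2 (n ℕ.∸ 1) (λ r → sgn (ix r) * X r c1)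
        + sumRange n 2 n (λ r → sgn (ix r) * X r c2)
    else if (ix i ℕ.≡ᵇ n) ∧ (toℕ j ℕ.≡ᵇ 1) then
      sumRange n 2 (n ℕ.∸ 1) (λ r → sgn (ix r ℕ.∸ 1) * X r c2)
        + sumRange n 1 (n ℕ.∸ 1) (λ r → sgn (ix r ℕ.∸ 1) * X r c1)
    else X i j

  _⊗_ : ∀ {m k p} → Mat m k → Mat k p → Mat m p
  _⊗_ {k = k} A B i j = sum {k} λ l → A i l * B l j

  _⊕_ : ∀ {m k} → Mat m k → Mat m k → Mat m k
  (A ⊕ B) i j = A i j + B i j

  _·_ : ∀ {m k} → Carrier → Mat m k → Mat m k
  (a · A) i j = a * A i j

  _≋_ : ∀ {m k} → Mat m k → Mat m k → Set ℓ
  A ≋ B = ∀ i j → A i j ≈ B i j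

  IsLinear : ∀ {n k} → (Mat n k → Mat n k) → Set (c ⊔ ℓ)
  IsLinear φ = (∀ X Y → φ (X ⊕ Y) ≋ (φ X ⊕ φ Y)) × (∀ a X → φ (a · X) ≋ (a · φ X))
    where open import Data.Product using (_×_)

  RowsEqual : ∀ {n k} → Mat n k → Set ℓ
  RowsEqual Z = ∀ i i′ j → Z i j ≈ Z i′ j

-- Write u, v for the columns of X. Then det₂ X = uᵀMv − vᵀMu for the strictly upper
-- triangular sign matrix M_ij = (−1)^(i+j−3), and T′ adds p e₁ to u and q eₙ to v. Row n and
-- column 1 of M vanish and M_1n = 1 (n is even), so the determinant changes by
-- pβ + qα + pq, where β = (Mv)₁ = Σ_{r=2}^{n} (−1)^r v_r and α = (uᵀM)ₙ = Σ_{r=1}^{n−1} (−1)^(r−1) u_r.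
-- The two new entries of T′ are chosen exactly so that p = β − α and q = α − β, and the
-- change vanishes. T′ fixes every entry outside (1,1) and (n,2); comparing two rows of T′ on
-- the matrix units E₁₁, E₁₂, E₂₁ eliminates φ and forces (A₁₁ − A₂₁)B₁₁ = 0,
-- (A₁₁ − A₂₁)B₂₂ = 1 and (A₂₂ − A₃₂)B₁₁ = 1, which are incompatible.

module Submission where

open import Defs
open import Level using (Level)
open import Data.Nat using (ℕ; _≤_)
open import Data.Nat.Divisibility using (_∣_)
open import Data.Product using (_×_; ∃)
open import Relation.Nullary using (¬_)

open import Algebra.Bundles using (CommutativeRing)
open import Data.Nat as ℕ using (zero; suc; s≤s; _∸_; _<_; _≡ᵇ_; _<ᵇ_; _≤ᵇ_)
import Data.Nat.Properties as ℕ
open import Data.Nat.Divisibility using (divides)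
open import Data.Integer as ℤ using (ℤ; +_; -[1+_]; _⊖_; sign; ∣_∣)
import Data.Integer.Properties as ℤ
open import Data.Sign as Sign using (Sign)
open import Data.Fin using (Fin; toℕ; fromℕ; inject₁) renaming (zero to fzero; suc to fsuc)
open import Data.Fin.Properties using (toℕ-injective; toℕ-fromℕ; toℕ-inject₁; toℕ<n; toℕ≤pred[n])
open import Data.Bool using (true; false; if_then_else_; _∧_; T)
open import Data.Bool.Properties using (∧-zeroʳ; ∧-identityʳ)
open import Data.Empty using (⊥-elim)
open import Data.Maybe using (Maybe; just; nothing)
open import Data.Product using (_,_)
open import Data.Vec.Functional using (tail)
open import Function using (_∘′_)
open import Relation.Nullary using (yes; no)
open import Relation.Binary.PropositionalEquality as ≡ using (_≡_)

if-true : ∀ {a} {A : Set a} {b} {x y : A} → T b → (if b then x else y) ≡ x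
if-true {b = true} _ = ≡.refl

if-false : ∀ {a} {A : Set a} {b} {x y : A} → ¬ T b → (if b then x else y) ≡ y
if-false {b = false} _  = ≡.refl
if-false {b = true}  ¬T = ⊥-elim (¬T _)

-- The ring solver over R with integer coefficients: the solver must decide equality of
-- coefficients, which is impossible for coefficients taken from R itself.
module IntegerCoefficients {c ℓ} (R : CommutativeRing c ℓ) where
  open CommutativeRing R
  open import Algebra.Properties.Ring ring using (-0#≈0#; -‿involutive; -‿+-comm; -1*x≈-x)
  open import Algebra.Properties.Semiring.Mult.TCOptimised semiring
    using (1+×; ×-homo-+; ×1-homo-*) renaming (_×_ to _·1_)
  open import Algebra.Solver.CommutativeMonoid +-commutativeMonoid
    using () renaming (solve to +-solve; _⊕_ to _⊞_; _⊜_ to _≐_)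
  open import Algebra.Solver.Ring.AlmostCommutativeRing
    using (fromCommutativeRing; _-Raw-AlmostCommutative⟶_)
  open import Relation.Binary.Reasoning.Setoid setoid

  ι : ℕ → Carrier
  ι n = n ·1 1#

  ⟦_⟧ : ℤ → Carrier
  ⟦ + n ⟧      = ι n
  ⟦ -[1+ n ] ⟧ = - ι (suc n)

  ⊖-homo : ∀ m n → ⟦ m ⊖ n ⟧ ≈ ι m - ι n
  ⊖-homo m       zero    = sym (trans (+-congˡ -0#≈0#) (+-identityʳ _))
  ⊖-homo zero    (suc n) = sym (+-identityˡ _)
  ⊖-homo (suc m) (suc n) = begin
    ⟦ suc m ⊖ suc n ⟧            ≡⟨ ≡.cong ⟦_⟧ (ℤ.[1+m]⊖[1+n]≡m⊖n m n) ⟩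
    ⟦ m ⊖ n ⟧                    ≈⟨ ⊖-homo m n ⟩
    ι m - ι n                    ≈⟨ +-congʳ (+-identityˡ _) ⟨
    (0# + ι m) - ι n             ≈⟨ +-congʳ (+-congʳ (-‿inverseʳ 1#)) ⟨
    ((1# - 1#) + ι m) - ι n      ≈⟨ +-solve 4 (λ a a′ b b′ → ((a ⊞ a′) ⊞ b) ⊞ b′ ≐ (a ⊞ b) ⊞ (a′ ⊞ b′))
                                            refl 1# (- 1#) (ι m) (- ι n) ⟩
    (1# + ι m) + (- 1# - ι n)    ≈⟨ +-congˡ (-‿+-comm 1# (ι n)) ⟩
    (1# + ι m) - (1# + ι n)      ≈⟨ +-cong (1+× m 1#) (-‿cong (1+× n 1#)) ⟨
    ι (suc m) - ι (suc n)        ∎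

  +-homo : ∀ i j → ⟦ i ℤ.+ j ⟧ ≈ ⟦ i ⟧ + ⟦ j ⟧
  +-homo (+ m)    (+ n)    = ×-homo-+ 1# m n
  +-homo (+ m)    -[1+ n ] = ⊖-homo m (suc n)
  +-homo -[1+ m ] (+ n)    = trans (⊖-homo n (suc m)) (+-comm _ _)
  +-homo -[1+ m ] -[1+ n ] = begin
    - ι (suc (suc (m ℕ.+ n)))  ≡⟨ ≡.cong (λ k → - ι (suc k)) (ℕ.+-suc m n) ⟨
    - ι (suc m ℕ.+ suc n)      ≈⟨ -‿cong (×-homo-+ 1# (suc m) (suc n)) ⟩
    - (ι (suc m) + ι (suc n))  ≈⟨ -‿+-comm _ _ ⟨
    - ι (suc m) - ι (suc n)    ∎

  signValue : Sign → Carrier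
  signValue Sign.+ = 1#
  signValue Sign.- = - 1#

  signValue-* : ∀ s t → signValue (s Sign.* t) ≈ signValue s * signValue t
  signValue-* Sign.+ t      = sym (*-identityˡ _)
  signValue-* Sign.- Sign.+ = sym (*-identityʳ _)
  signValue-* Sign.- Sign.- = sym (trans (-1*x≈-x _) (-‿involutive _))

  ◃-homo : ∀ s n → ⟦ s ℤ.◃ n ⟧ ≈ signValue s * ι n
  ◃-homo s      zero    = sym (zeroʳ _)
  ◃-homo Sign.+ (suc n) = sym (*-identityˡ _)
  ◃-homo Sign.- (suc n) = sym (-1*x≈-x _)

  sign-abs : ∀ i → ⟦ i ⟧ ≈ signValue (sign i) * ι ∣ i ∣
  sign-abs (+ n)    = sym (*-identityˡ _)
  sign-abs -[1+ n ] = sym (-1*x≈-x _)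

  *-homo : ∀ i j → ⟦ i ℤ.* j ⟧ ≈ ⟦ i ⟧ * ⟦ j ⟧
  *-homo i j = begin
    ⟦ (sign i Sign.* sign j) ℤ.◃ (∣ i ∣ ℕ.* ∣ j ∣) ⟧
      ≈⟨ ◃-homo (sign i Sign.* sign j) (∣ i ∣ ℕ.* ∣ j ∣) ⟩
    signValue (sign i Sign.* sign j) * ι (∣ i ∣ ℕ.* ∣ j ∣)
      ≈⟨ *-cong (signValue-* (sign i) (sign j)) (×1-homo-* ∣ i ∣ ∣ j ∣) ⟩
    (signValue (sign i) * signValue (sign j)) * (ι ∣ i ∣ * ι ∣ j ∣)
      ≈⟨ middleFour (signValue (sign i)) (signValue (sign j)) (ι ∣ i ∣) (ι ∣ j ∣) ⟩
    (signValue (sign i) * ι ∣ i ∣) * (signValue (sign j) * ι ∣ j ∣)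
      ≈⟨ *-cong (sign-abs i) (sign-abs j) ⟨
    ⟦ i ⟧ * ⟦ j ⟧ ∎
    where
    open import Algebra.Properties.CommutativeSemigroup *-commutativeSemigroup
      using () renaming (interchange to middleFour)

  neg-homo : ∀ i → ⟦ ℤ.- i ⟧ ≈ - ⟦ i ⟧
  neg-homo (+ zero)  = sym -0#≈0#
  neg-homo (+ suc n) = refl
  neg-homo -[1+ n ]  = sym (-‿involutive _)

  morphism : ℤ.+-*-rawRing -Raw-AlmostCommutative⟶ fromCommutativeRing R
  morphism = record
    { ⟦_⟧ = ⟦_⟧ ; +-homo = +-homo ; *-homo = *-homo ; -‿homo = neg-homo
    ; 0-homo = refl ; 1-homo = refl }

  coefficient≟ : ∀ i j → Maybe (⟦ i ⟧ ≈ ⟦ j ⟧)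
  coefficient≟ i j with i ℤ.≟ j
  ... | yes ≡.refl = just refl
  ... | no _       = nothing

  open import Algebra.Solver.Ring ℤ.+-*-rawRing (fromCommutativeRing R) morphism coefficient≟ public
    using (solve; _:=_; _:+_; _:*_; :-_; _:-_; con)

module Bilinear {c ℓ} (R : CommutativeRing c ℓ) where
  open CommutativeRing R
  open import Algebra.Properties.Ring ring using (-1*x≈-x)
  open import Algebra.Properties.Semiring.Sum semiring
    using (sum; sum-cong-≋; sum-replicate-zero; ∑-distrib-+; *-distribˡ-sum)
  open IntegerCoefficients R using (solve; _:=_; _:+_; _:*_; _:-_; con)
  open import Relation.Binary.Reasoning.Setoid setoid

  sum-zero : ∀ {n} {f : Fin n → Carrier} → (∀ i → f i ≈ 0#) → sum f ≈ 0#
  sum-zero {n} f≈0 = trans (sum-cong-≋ f≈0) (sum-replicate-zero n)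

  sum-+-* : ∀ {n} (f g : Fin n → Carrier) a → sum (λ i → f i + a * g i) ≈ sum f + a * sum g
  sum-+-* f g a = trans (∑-distrib-+ f (λ i → a * g i)) (+-congˡ (sym (*-distribˡ-sum a g)))

  sum-neg : ∀ {n} (f : Fin n → Carrier) → sum (λ i → - f i) ≈ - sum f
  sum-neg f = begin
    sum (λ i → - f i)       ≈⟨ sum-cong-≋ (λ i → -1*x≈-x (f i)) ⟨
    sum (λ i → - 1# * f i)  ≈⟨ *-distribˡ-sum (- 1#) f ⟨
    - 1# * sum f            ≈⟨ -1*x≈-x (sum f) ⟩
    - sum f                 ∎

  sum-sub : ∀ {n} (f g : Fin n → Carrier) → sum (λ i → f i - g i) ≈ sum f - sum g
  sum-sub f g = trans (∑-distrib-+ f (λ i → - g i)) (+-congˡ (sum-neg g))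

  if-0-*ʳ : ∀ b s t → (if b then s * t else 0#) ≈ (if b then s else 0#) * t
  if-0-*ʳ true  s t = refl
  if-0-*ʳ false s t = sym (zeroˡ t)

  δ : ∀ {n} → Fin n → Fin n → Carrier
  δ k i = if toℕ i ≡ᵇ toℕ k then 1# else 0#

  sum-δ : ∀ {n} (k : Fin n) (f : Fin n → Carrier) → sum (λ i → δ k i * f i) ≈ f k
  sum-δ fzero f = trans (+-cong (*-identityˡ (f fzero)) (sum-zero (λ i → zeroˡ (f (fsuc i)))))
                        (+-identityʳ (f fzero))
  sum-δ (fsuc k) f = trans (+-congʳ (zeroˡ (f fzero))) (trans (+-identityˡ _) (sum-δ k (f ∘′ fsuc)))

  if-as-update : ∀ b {x x₀ y} → (b ≡ true → x ≈ x₀) →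
                 (if b then y else x) ≈ x + (y - x₀) * (if b then 1# else 0#)
  if-as-update true  {x} {x₀} {y} x≈x₀ =
    trans (solve 2 (λ x₀ y → y := x₀ :+ (y :- x₀) :* con (ℤ.+ 1)) refl x₀ y)
          (+-congʳ (sym (x≈x₀ ≡.refl)))
  if-as-update false {x} x≈x₀ = sym (trans (+-congˡ (zeroʳ _)) (+-identityʳ x))

  update-at : ∀ {n} (k : Fin n) (z : Fin n → Carrier) y i →
              (if toℕ i ≡ᵇ toℕ k then y else z i) ≈ z i + (y - z k) * δ k i
  update-at k z y i = if-as-update (toℕ i ≡ᵇ toℕ k) λ i≡ᵇk →
    reflexive (≡.cong z (toℕ-injective (ℕ.≡ᵇ⇒≡ (toℕ i) (toℕ k) (≡.subst T (≡.sym i≡ᵇk) _))))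

  bilinear : ∀ {n} → (Fin n → Fin n → Carrier) → (Fin n → Carrier) → (Fin n → Carrier) → Carrier
  bilinear M x y = sum λ i → x i * sum λ j → M i j * y j

  bilinear-cong : ∀ {n} M {x x′ y y′ : Fin n → Carrier} →
                  (∀ i → x i ≈ x′ i) → (∀ j → y j ≈ y′ j) → bilinear M x y ≈ bilinear M x′ y′
  bilinear-cong M x≈x′ y≈y′ =
    sum-cong-≋ λ i → *-cong (x≈x′ i) (sum-cong-≋ λ j → *-congˡ (y≈y′ j))

  dot-update : ∀ {n} (w x : Fin n → Carrier) a k →
               sum (λ i → w i * (x i + a * δ k i)) ≈ sum (λ i → w i * x i) + a * w k
  dot-update w x a k = begin
    sum (λ i → w i * (x i + a * δ k i))      ≈⟨ sum-cong-≋ (λ i → expand (w i) (x i) (δ k i)) ⟩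
    sum (λ i → w i * x i + a * (δ k i * w i)) ≈⟨ sum-+-* (λ i → w i * x i) (λ i → δ k i * w i) a ⟩
    sum (λ i → w i * x i) + a * sum (λ i → δ k i * w i) ≈⟨ +-congˡ (*-congˡ (sum-δ k w)) ⟩
    sum (λ i → w i * x i) + a * w k          ∎
    where
    expand : ∀ w x d → w * (x + a * d) ≈ w * x + a * (d * w)
    expand = solve 4 (λ a w x d → w :* (x :+ a :* d) := w :* x :+ a :* (d :* w)) refl a

  bilinear-update : ∀ {n} M (x y : Fin n → Carrier) a k b l →
    bilinear M (λ i → x i + a * δ k i) (λ j → y j + b * δ l j)
      ≈ ((bilinear M x y + a * sum (λ j → M k j * y j)) + b * sum (λ i → x i * M i l)) + (a * b) * M k l
  bilinear-update M x y a k b l = begin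
    bilinear M (λ i → x i + a * δ k i) (λ j → y j + b * δ l j)
      ≈⟨ sum-cong-≋ (λ i → *-congˡ (dot-update (M i) y b l)) ⟩
    sum (λ i → (x i + a * δ k i) * (r i + b * M i l))
      ≈⟨ sum-cong-≋ (λ i → expand (x i) (δ k i) (r i) (M i l)) ⟩
    sum (λ i → (x i * r i + b * (x i * M i l)) + a * (δ k i * (r i + b * M i l)))
      ≈⟨ sum-+-* (λ i → x i * r i + b * (x i * M i l)) (λ i → δ k i * (r i + b * M i l)) a ⟩
    sum (λ i → x i * r i + b * (x i * M i l)) + a * sum (λ i → δ k i * (r i + b * M i l))
      ≈⟨ +-cong (sum-+-* (λ i → x i * r i) (λ i → x i * M i l) b)
                (*-congˡ (sum-δ k (λ i → r i + b * M i l))) ⟩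
    (bilinear M x y + b * sum (λ i → x i * M i l)) + a * (r k + b * M k l)
      ≈⟨ regroup (bilinear M x y) (sum (λ i → x i * M i l)) (r k) (M k l) ⟩
    ((bilinear M x y + a * r k) + b * sum (λ i → x i * M i l)) + (a * b) * M k l ∎
    where
    r : _ → Carrier
    r i = sum λ j → M i j * y j
    expand : ∀ x d r m → (x + a * d) * (r + b * m) ≈ (x * r + b * (x * m)) + a * (d * (r + b * m))
    expand = solve 6 (λ a b x d r m →
      (x :+ a :* d) :* (r :+ b :* m) := (x :* r :+ b :* (x :* m)) :+ a :* (d :* (r :+ b :* m))) refl a b
    regroup : ∀ B S r m → (B + b * S) + a * (r + b * m) ≈ ((B + a * r) + b * S) + (a * b) * m
    regroup = solve 6 (λ a b B S r m →
      (B :+ b :* S) :+ a :* (r :+ b :* m) := ((B :+ a :* r) :+ b :* S) :+ (a :* b) :* m) refl a b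

  skew : ∀ {n} → (Fin n → Fin n → Carrier) → (Fin n → Carrier) → (Fin n → Carrier) → Carrier
  skew M x y = bilinear M x y - bilinear M y x

  double-sum-skew : ∀ {n} M (x y : Fin n → Carrier) →
    sum (λ i → sum (λ j → M i j * (x i * y j - y i * x j))) ≈ skew M x y
  double-sum-skew M x y = begin
    sum (λ i → sum (λ j → M i j * (x i * y j - y i * x j)))
      ≈⟨ sum-cong-≋ (λ i → sum-cong-≋ (λ j → expand (M i j) (x i) (y j) (y i) (x j))) ⟩
    sum (λ i → sum (λ j → x i * (M i j * y j) - y i * (M i j * x j)))
      ≈⟨ sum-cong-≋ (λ i → sum-sub (λ j → x i * (M i j * y j)) (λ j → y i * (M i j * x j))) ⟩
    sum (λ i → sum (λ j → x i * (M i j * y j)) - sum (λ j → y i * (M i j * x j)))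
      ≈⟨ sum-cong-≋ (λ i → +-cong (*-distribˡ-sum (x i) (λ j → M i j * y j))
                                  (-‿cong (*-distribˡ-sum (y i) (λ j → M i j * x j)))) ⟨
    sum (λ i → x i * sum (λ j → M i j * y j) - y i * sum (λ j → M i j * x j))
      ≈⟨ sum-sub (λ i → x i * sum (λ j → M i j * y j)) (λ i → y i * sum (λ j → M i j * x j)) ⟩
    bilinear M x y - bilinear M y x ∎
    where
    expand : ∀ m x y y′ x′ → m * (x * y - y′ * x′) ≈ x * (m * y) - y′ * (m * x′)
    expand = solve 5 (λ m x y y′ x′ → m :* (x :* y :- y′ :* x′) := x :* (m :* y) :- y′ :* (m :* x′)) refl

  skew-update : ∀ {n} M (x y : Fin n → Carrier) a k b l → (∀ j → M l j ≈ 0#) → (∀ i → M i k ≈ 0#) →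
    skew M (λ i → x i + a * δ k i) (λ j → y j + b * δ l j)
      ≈ skew M x y + ((a * sum (λ j → M k j * y j) + b * sum (λ i → x i * M i l)) + (a * b) * M k l)
  skew-update M x y a k b l row-l≈0 column-k≈0 = begin
    skew M (λ i → x i + a * δ k i) (λ j → y j + b * δ l j)
      ≈⟨ +-cong (bilinear-update M x y a k b l) (-‿cong (bilinear-update M y x b l a k)) ⟩
    (((bilinear M x y + a * ρ) + b * κ) + (a * b) * M k l)
      - (((bilinear M y x + b * sum (λ j → M l j * x j)) + a * sum (λ i → y i * M i k))
          + (b * a) * M l k)
      ≈⟨ +-congˡ (-‿cong (+-cong (+-cong (+-congˡ (*-congˡ row-l-sum)) (*-congˡ column-k-sum))
                                 (*-congˡ (column-k≈0 l)))) ⟩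
    (((bilinear M x y + a * ρ) + b * κ) + (a * b) * M k l)
      - (((bilinear M y x + b * 0#) + a * 0#) + (b * a) * 0#)
      ≈⟨ regroup (bilinear M x y) (bilinear M y x) ρ κ (M k l) ⟩
    skew M x y + ((a * ρ + b * κ) + (a * b) * M k l) ∎
    where
    ρ κ : Carrier
    ρ = sum (λ j → M k j * y j)
    κ = sum (λ i → x i * M i l)
    row-l-sum : sum (λ j → M l j * x j) ≈ 0#
    row-l-sum = sum-zero λ j → trans (*-congʳ (row-l≈0 j)) (zeroˡ (x j))
    column-k-sum : sum (λ i → y i * M i k) ≈ 0#
    column-k-sum = sum-zero λ i → trans (*-congˡ (column-k≈0 i)) (zeroʳ (y i))
    regroup : ∀ Bxy Byx r c m →
      (((Bxy + a * r) + b * c) + (a * b) * m) - (((Byx + b * 0#) + a * 0#) + (b * a) * 0#)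
        ≈ (Bxy - Byx) + ((a * r + b * c) + (a * b) * m)
    regroup = solve 7 (λ a b Bxy Byx r c m →
      (((Bxy :+ a :* r) :+ b :* c) :+ (a :* b) :* m)
        :- (((Byx :+ b :* con (ℤ.+ 0)) :+ a :* con (ℤ.+ 0)) :+ (b :* a) :* con (ℤ.+ 0))
      := (Bxy :- Byx) :+ ((a :* r :+ b :* c) :+ (a :* b) :* m)) refl a b

module CullisForm {c ℓ} (F : Field c ℓ) where
  open Field F
  open FieldDefs F
  open Bilinear commutativeRing
  open IntegerCoefficients commutativeRing using (solve; _:=_; _:+_; _:*_; :-_; _:-_; con)
  open import Algebra.Properties.Ring ring using (-‿involutive; -‿distribˡ-*)
  open import Algebra.Properties.Semiring.Sum semiring using (sum; sum-cong-≋; sum-init-last)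
  open import Relation.Binary.Reasoning.Setoid setoid

  column : ∀ {n} → Mat n 2 → Fin 2 → Fin n → Carrier
  column Z j i = Z i j

  cullisSign : ∀ {n} → Fin n → Fin n → Carrier
  cullisSign i j = if ix i <ᵇ ix j then sgn ((ix i ℕ.+ ix j) ∸ 3) else 0#

  det₂≈skew : ∀ {n} (Z : Mat n 2) →
    det₂ Z ≈ skew cullisSign (column Z c1) (column Z c2)
  det₂≈skew {n} Z = trans (sum-cong-≋ {n} λ i → sum-cong-≋ {n} λ j → if-0-*ʳ (ix i <ᵇ ix j) _ _)
                      (double-sum-skew cullisSign (column Z c1) (column Z c2))

  cullisSign-last-row : ∀ {n} j → cullisSign (fromℕ n) j ≡ 0#
  cullisSign-last-row {n} j = if-false λ last<j →
    ℕ.<⇒≱ (≡.subst (_< toℕ j) (toℕ-fromℕ n) (ℕ.<ᵇ⇒< _ _ last<j)) (toℕ≤pred[n] j)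

  T′₁₁ T′ₙ₂ : ∀ {n} → Mat n 2 → Carrier
  T′₁₁ {n} X = sumRange n 2 (n ∸ 1) (λ r → sgn (ix r) * X r c1)
             + sumRange n 2 n (λ r → sgn (ix r) * X r c2)
  T′ₙ₂ {n} X = sumRange n 2 (n ∸ 1) (λ r → sgn (ix r ∸ 1) * X r c2)
             + sumRange n 1 (n ∸ 1) (λ r → sgn (ix r ∸ 1) * X r c1)

  T′-column₁ : ∀ {n} (X : Mat (suc n) 2) i → T′ X i c1 ≈ X i c1 + (T′₁₁ X - X fzero c1) * δ fzero i
  T′-column₁ X i = trans (reflexive shape) (update-at fzero (column X c1) (T′₁₁ X) i)
    where
    shape : T′ X i c1 ≡ (if toℕ i ≡ᵇ 0 then T′₁₁ X else X i c1)
    shape = ≡.cong₂ (λ b b′ → if b then T′₁₁ X else if b′ then T′ₙ₂ X else X i c1)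
                    (∧-identityʳ _) (∧-zeroʳ _)

  T′-column₂ : ∀ {n} (X : Mat (suc n) 2) i →
    T′ X i c2 ≈ X i c2 + (T′ₙ₂ X - X (fromℕ n) c2) * δ (fromℕ n) i
  T′-column₂ {n} X i = trans (reflexive shape) (update-at (fromℕ n) (column X c2) (T′ₙ₂ X) i)
    where
    shape : T′ X i c2 ≡ (if toℕ i ≡ᵇ toℕ (fromℕ n) then T′ₙ₂ X else X i c2)
    shape = ≡.cong₂ (λ b b′ → if b then T′₁₁ X else if b′ then T′ₙ₂ X else X i c2)
                    (∧-zeroʳ (ix i ≡ᵇ 1))
                    (≡.trans (∧-identityʳ (ix i ≡ᵇ suc n)) (≡.cong (toℕ i ≡ᵇ_) (≡.sym (toℕ-fromℕ n))))

  window : ℕ → ℕ → (ℕ → Carrier) → ℕ → Carrier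
  window lo hi s k = if (lo ≤ᵇ k) ∧ (k ≤ᵇ hi) then s k else 0#

  sumRange-window : ∀ {n} lo hi (s : ℕ → Carrier) (z : Fin n → Carrier) →
    sumRange n lo hi (λ r → s (ix r) * z r) ≈ sum (λ r → window lo hi s (ix r) * z r)
  sumRange-window {n} lo hi s z = sum-cong-≋ {n} λ r → if-0-*ʳ ((lo ≤ᵇ ix r) ∧ (ix r ≤ᵇ hi)) _ _

  module Even (m : ℕ) (sgn-m : sgn m ≈ 1#) where
    n : ℕ
    n = suc (suc m)

    first last : Fin n
    first = fzero
    last  = fromℕ (suc m)

    inner : Fin m → Fin n
    inner i = fsuc (inject₁ i)

    -- Σ_{r = 2}^{n - 1} (-1)^r z_r, where row inner i has 1-based index r = toℕ (inject₁ i) + 2.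
    alternatingSum : (Fin n → Carrier) → Carrier
    alternatingSum z = sum λ i → sgn (toℕ (inject₁ i)) * z (inner i)

    weighted-sum : ∀ (w : ℕ → Carrier) (z : Fin n → Carrier) {a s b} → w 1 ≈ a →
      sum (λ i → w (2 ℕ.+ toℕ (inject₁ i)) * z (inner i)) ≈ s → w (2 ℕ.+ m) ≈ b →
      sum (λ r → w (ix r) * z r) ≈ a * z first + (s + b * z last)
    weighted-sum w z {s = s} {b} w₁≈a interior≈s wₙ≈b = +-cong (*-congʳ w₁≈a) (begin
      sum (tail λ r → w (ix r) * z r)
        ≈⟨ sum-init-last (tail λ r → w (ix r) * z r) ⟩
      sum (λ i → w (2 ℕ.+ toℕ (inject₁ i)) * z (inner i)) + w (ix last) * z last
        ≈⟨ +-cong interior≈s (*-congʳ (trans (reflexive (≡.cong (λ k → w (2 ℕ.+ k)) (toℕ-fromℕ m))) wₙ≈b)) ⟩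
      s + b * z last ∎)

    inject₁<m : (i : Fin m) → toℕ (inject₁ i) < m
    inject₁<m i = ≡.subst (_< m) (≡.sym (toℕ-inject₁ i)) (toℕ<n i)

    interior-sgn : ∀ (w : ℕ → Carrier) (z : Fin n → Carrier) →
      (∀ t → t < m → w (2 ℕ.+ t) ≈ sgn t) →
      sum (λ i → w (2 ℕ.+ toℕ (inject₁ i)) * z (inner i)) ≈ alternatingSum z
    interior-sgn w z w≈ = sum-cong-≋ λ i → *-congʳ (w≈ _ (inject₁<m i))

    interior-neg-sgn : ∀ (w : ℕ → Carrier) (z : Fin n → Carrier) →
      (∀ t → t < m → w (2 ℕ.+ t) ≈ - sgn t) →
      sum (λ i → w (2 ℕ.+ toℕ (inject₁ i)) * z (inner i)) ≈ - alternatingSum z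
    interior-neg-sgn w z w≈ = trans
      (sum-cong-≋ λ i → trans (*-congʳ (w≈ _ (inject₁<m i))) (sym (-‿distribˡ-* _ _)))
      (sum-neg λ i → sgn (toℕ (inject₁ i)) * z (inner i))

    m≮m : ¬ T (m <ᵇ m)
    m≮m m<m = ℕ.n≮n m (ℕ.<ᵇ⇒< m m m<m)

    sgn-2+ : ∀ t → sgn (2 ℕ.+ t) ≈ sgn t
    sgn-2+ t = -‿involutive (sgn t)

    sgn-+m : ∀ t → sgn (t ℕ.+ m) ≈ sgn t
    sgn-+m zero    = sgn-m
    sgn-+m (suc t) = -‿cong (sgn-+m t)

    drop-ends : ∀ f s l → 0# * f + (s + 0# * l) ≈ s
    drop-ends = solve 3 (λ f s l → con (ℤ.+ 0) :* f :+ (s :+ con (ℤ.+ 0) :* l) := s) refl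

    keep-last : ∀ f s l → 0# * f + (s + 1# * l) ≈ s + l
    keep-last = solve 3 (λ f s l → con (ℤ.+ 0) :* f :+ (s :+ con (ℤ.+ 1) :* l) := s :+ l) refl

    keep-first : ∀ f s l → 1# * f + (s + 0# * l) ≈ f + s
    keep-first = solve 3 (λ f s l → con (ℤ.+ 1) :* f :+ (s :+ con (ℤ.+ 0) :* l) := f :+ s) refl

    sumRange-sgn-inner : ∀ z → sumRange n 2 (suc m) (λ r → sgn (ix r) * z r) ≈ alternatingSum z
    sumRange-sgn-inner z = trans (sumRange-window 2 (suc m) sgn z) (trans
      (weighted-sum (window 2 (suc m) sgn) z refl
        (interior-sgn (window 2 (suc m) sgn) z λ t t<m →
          trans (reflexive (if-true (ℕ.<⇒<ᵇ t<m))) (sgn-2+ t))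
        (reflexive (if-false m≮m)))
      (drop-ends _ _ _))

    sumRange-sgn-tail : ∀ z → sumRange n 2 n (λ r → sgn (ix r) * z r) ≈ alternatingSum z + z last
    sumRange-sgn-tail z = trans (sumRange-window 2 n sgn z) (trans
      (weighted-sum (window 2 n sgn) z refl
        (interior-sgn (window 2 n sgn) z λ t t<m →
          trans (reflexive (if-true (ℕ.<⇒<ᵇ (ℕ.m<n⇒m<1+n t<m)))) (sgn-2+ t))
        (trans (reflexive (if-true (ℕ.<⇒<ᵇ (ℕ.n<1+n m)))) (trans (sgn-2+ m) sgn-m)))
      (keep-last _ _ _))

    sumRange-sgn-pred-inner : ∀ z →
      sumRange n 2 (suc m) (λ r → sgn (ix r ∸ 1) * z r) ≈ - alternatingSum z
    sumRange-sgn-pred-inner z = trans (sumRange-window 2 (suc m) (λ k → sgn (k ∸ 1)) z) (trans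
      (weighted-sum (window 2 (suc m) λ k → sgn (k ∸ 1)) z refl
        (interior-neg-sgn (window 2 (suc m) λ k → sgn (k ∸ 1)) z λ t t<m →
          reflexive (if-true (ℕ.<⇒<ᵇ t<m)))
        (reflexive (if-false m≮m)))
      (drop-ends _ _ _))

    sumRange-sgn-pred-head : ∀ z →
      sumRange n 1 (suc m) (λ r → sgn (ix r ∸ 1) * z r) ≈ z first - alternatingSum z
    sumRange-sgn-pred-head z = trans (sumRange-window 1 (suc m) (λ k → sgn (k ∸ 1)) z) (trans
      (weighted-sum (window 1 (suc m) λ k → sgn (k ∸ 1)) z refl
        (interior-neg-sgn (window 1 (suc m) λ k → sgn (k ∸ 1)) z λ t t<m →
          reflexive (if-true (ℕ.<⇒<ᵇ t<m)))
        (reflexive (if-false m≮m)))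
      (keep-first _ _ _))

    first-row-sum : ∀ z → sum (λ j → cullisSign first j * z j) ≈ alternatingSum z + z last
    first-row-sum z =
      trans (weighted-sum w z refl (interior-sgn w z λ t _ → refl) sgn-m) (keep-last _ _ _)
      where
      w : ℕ → Carrier
      w k = if 1 <ᵇ k then sgn (suc k ∸ 3) else 0#

    last-column-sum : ∀ z → sum (λ i → z i * cullisSign i last) ≈ z first - alternatingSum z
    last-column-sum z = begin
      sum (λ i → z i * cullisSign i last)
        ≈⟨ sum-cong-≋ (λ i → trans (*-comm (z i) _) (*-congʳ (reflexive (weight i)))) ⟩
      sum (λ i → w (ix i) * z i)
        ≈⟨ weighted-sum w z sgn-m (interior-neg-sgn w z w-inner) (reflexive (if-false m≮m)) ⟩
      1# * z first + (- alternatingSum z + 0# * z last)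
        ≈⟨ keep-first _ _ _ ⟩
      z first - alternatingSum z ∎
      where
      w : ℕ → Carrier
      w k = if k <ᵇ 2 ℕ.+ m then sgn ((k ℕ.+ (2 ℕ.+ m)) ∸ 3) else 0#
      weight : ∀ i → cullisSign i last ≡ w (ix i)
      weight i =
        ≡.cong (λ k → if ix i <ᵇ 2 ℕ.+ k then sgn ((ix i ℕ.+ (2 ℕ.+ k)) ∸ 3) else 0#) (toℕ-fromℕ m)
      w-inner : ∀ t → t < m → w (2 ℕ.+ t) ≈ - sgn t
      w-inner t t<m = begin
        w (2 ℕ.+ t)                     ≡⟨ if-true (ℕ.<⇒<ᵇ t<m) ⟩
        sgn ((t ℕ.+ suc (suc m)) ∸ 1)   ≡⟨ ≡.cong (λ k → sgn (k ∸ 1)) (ℕ.+-suc t (suc m)) ⟩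
        sgn (t ℕ.+ suc m)               ≡⟨ ≡.cong sgn (ℕ.+-suc t m) ⟩
        - sgn (t ℕ.+ m)                 ≈⟨ -‿cong (sgn-+m t) ⟩
        - sgn t                         ∎

    cullisSign-first-last : cullisSign first last ≈ 1#
    cullisSign-first-last = trans (reflexive (≡.cong sgn (toℕ-fromℕ m))) sgn-m

    T′₁₁-eval : ∀ X →
      T′₁₁ X ≈ alternatingSum (column X c1) + (alternatingSum (column X c2) + X last c2)
    T′₁₁-eval X = +-cong (sumRange-sgn-inner (column X c1)) (sumRange-sgn-tail (column X c2))

    T′ₙ₂-eval : ∀ X →
      T′ₙ₂ X ≈ - alternatingSum (column X c2) + (X first c1 - alternatingSum (column X c1))
    T′ₙ₂-eval X = +-cong (sumRange-sgn-pred-inner (column X c2)) (sumRange-sgn-pred-head (column X c1))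

    det₂-T′ : ∀ (X : Mat n 2) → det₂ (T′ X) ≈ det₂ X
    det₂-T′ X = begin
      det₂ (T′ X)
        ≈⟨ det₂≈skew (T′ X) ⟩
      skew M (column (T′ X) c1) (column (T′ X) c2)
        ≈⟨ +-cong (bilinear-cong M col₁ col₂) (-‿cong (bilinear-cong M col₂ col₁)) ⟩
      skew M (λ i → u i + p * δ first i) (λ j → v j + q * δ last j)
        ≈⟨ skew-update M u v p first q last (λ j → reflexive (cullisSign-last-row j)) (λ i → refl) ⟩
      skew M u v
        + ((p * sum (λ j → M first j * v j) + q * sum (λ i → u i * M i last)) + (p * q) * M first last)
        ≈⟨ +-congˡ (+-cong (+-cong (*-cong p≈ (first-row-sum v)) (*-cong q≈ (last-column-sum u)))
                           (*-cong (*-cong p≈ q≈) cullisSign-first-last)) ⟩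
      skew M u v + (((β - α) * β + (α - β) * α) + ((β - α) * (α - β)) * 1#)
        ≈⟨ +-congˡ (cancel α β) ⟩
      skew M u v + 0#
        ≈⟨ +-identityʳ _ ⟩
      skew M u v
        ≈⟨ det₂≈skew X ⟨
      det₂ X ∎
      where
      M : Fin n → Fin n → Carrier
      M = cullisSign
      u v : Fin n → Carrier
      u = column X c1
      v = column X c2
      p q α β : Carrier
      p = T′₁₁ X - u first
      q = T′ₙ₂ X - v last
      α = u first - alternatingSum u
      β = alternatingSum v + v last
      col₁ : ∀ i → T′ X i c1 ≈ u i + p * δ first i
      col₁ = T′-column₁ X
      col₂ : ∀ i → T′ X i c2 ≈ v i + q * δ last i
      col₂ = T′-column₂ X
      p≈ : p ≈ β - α
      p≈ = trans (+-congʳ (T′₁₁-eval X))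
        (solve 4 (λ Su Sv u₀ vₙ → (Su :+ (Sv :+ vₙ)) :- u₀ := (Sv :+ vₙ) :- (u₀ :- Su)) refl
               (alternatingSum u) (alternatingSum v) (u first) (v last))
      q≈ : q ≈ α - β
      q≈ = trans (+-congʳ (T′ₙ₂-eval X))
        (solve 4 (λ Su Sv u₀ vₙ → (:- Sv :+ (u₀ :- Su)) :- vₙ := (u₀ :- Su) :- (Sv :+ vₙ)) refl
               (alternatingSum u) (alternatingSum v) (u first) (v last))
      cancel : ∀ α β → ((β - α) * β + (α - β) * α) + ((β - α) * (α - β)) * 1# ≈ 0#
      cancel = solve 2 (λ α β → ((β :- α) :* β :+ (α :- β) :* α) :+ ((β :- α) :* (α :- β)) :* con (ℤ.+ 1)
                               := con (ℤ.+ 0)) refl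

  matrixUnit : ∀ {n k} → Fin n → Fin k → Mat n k
  matrixUnit a b i j = δ a i * δ b j

  ⊗-matrixUnit : ∀ {m n k p} (A : Mat m n) (B : Mat k p) a b i j →
                 ((A ⊗ matrixUnit a b) ⊗ B) i j ≈ A i a * B b j
  ⊗-matrixUnit {n = n} {k} A B a b i j = begin
    sum (λ l → sum (λ r → A i r * (δ a r * δ b l)) * B l j)
      ≈⟨ sum-cong-≋ {k} (λ l → *-congʳ (trans (sum-cong-≋ {n} λ r → swap (A i r) (δ a r) (δ b l))
                                               (sum-δ a λ r → A i r * δ b l))) ⟩
    sum (λ l → (A i a * δ b l) * B l j)
      ≈⟨ sum-cong-≋ {k} (λ l → swap′ (A i a) (δ b l) (B l j)) ⟩
    sum (λ l → δ b l * (A i a * B l j))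
      ≈⟨ sum-δ b (λ l → A i a * B l j) ⟩
    A i a * B b j ∎
    where
    swap : ∀ x d e → x * (d * e) ≈ d * (x * e)
    swap = solve 3 (λ x d e → x :* (d :* e) := d :* (x :* e)) refl
    swap′ : ∀ x d y → (x * d) * y ≈ d * (x * y)
    swap′ = solve 3 (λ x d y → (x :* d) :* y := d :* (x :* y)) refl

  module NonStandard (m′ : ℕ) (sgn-m : sgn (2 ℕ.+ m′) ≈ 1#) where
    open Even (2 ℕ.+ m′) sgn-m

    r₁ r₂ r₃ : Fin n
    r₁ = fzero
    r₂ = fsuc fzero
    r₃ = fsuc (fsuc fzero)

    T′₁₁-matrixUnit : T′ (matrixUnit r₁ c1) r₁ c1 ≈ 0#
    T′₁₁-matrixUnit = trans (T′₁₁-eval (matrixUnit r₁ c1))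
      (trans (+-cong (interior≈0 c1) (trans (+-cong (interior≈0 c2) (zeroˡ 0#)) (+-identityʳ 0#)))
             (+-identityʳ 0#))
      where
      interior≈0 : ∀ j → alternatingSum (column (matrixUnit r₁ c1) j) ≈ 0#
      interior≈0 j = sum-zero {2 ℕ.+ m′} λ i →
        trans (*-congˡ (zeroˡ (δ c1 j))) (zeroʳ (sgn (toℕ (inject₁ i))))

    T′-not-standard : ¬ (∃ λ (A : Mat n n) → ∃ λ (B : Mat 2 2) → ∃ λ (φ : Mat n 2 → Mat n 2) →
        IsLinear φ × (∀ X → RowsEqual (φ X)) × (∀ X → T′ X ≋ (((A ⊗ X) ⊗ B) ⊕ φ X)))
    T′-not-standard (A , B , φ , _ , rows-equal , T′≋) = 0≉1 (sym 1≈0)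
      where
      unit-row-difference : ∀ a b i i′ j →
        T′ (matrixUnit a b) i j - T′ (matrixUnit a b) i′ j ≈ A i a * B b j - A i′ a * B b j
      unit-row-difference a b i i′ j = let X = matrixUnit a b in begin
        T′ X i j - T′ X i′ j
          ≈⟨ +-cong (T′≋ X i j) (-‿cong (trans (T′≋ X i′ j) (+-congˡ (rows-equal X i′ i j)))) ⟩
        (((A ⊗ X) ⊗ B) i j + φ X i j) - (((A ⊗ X) ⊗ B) i′ j + φ X i j)
          ≈⟨ solve 3 (λ P P′ f → (P :+ f) :- (P′ :+ f) := P :- P′) refl _ _ _ ⟩
        ((A ⊗ X) ⊗ B) i j - ((A ⊗ X) ⊗ B) i′ j
          ≈⟨ +-cong (⊗-matrixUnit A B a b i j) (-‿cong (⊗-matrixUnit A B a b i′ j)) ⟩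
        A i a * B b j - A i′ a * B b j ∎
      one-minus-zero : 1# * 1# - 0# * 1# ≈ 1#
      one-minus-zero =
        solve 0 (con (ℤ.+ 1) :* con (ℤ.+ 1) :- con (ℤ.+ 0) :* con (ℤ.+ 1) := con (ℤ.+ 1)) refl
      from-E₁₁ : 0# ≈ A r₁ r₁ * B c1 c1 - A r₂ r₁ * B c1 c1
      from-E₁₁ = trans (sym (trans (+-cong T′₁₁-matrixUnit (-‿cong (zeroˡ 1#))) (-‿inverseʳ 0#)))
                 (unit-row-difference r₁ c1 r₁ r₂ c1)
      from-E₁₂ : 1# ≈ A r₁ r₁ * B c2 c2 - A r₂ r₁ * B c2 c2
      from-E₁₂ = trans (sym one-minus-zero) (unit-row-difference r₁ c2 r₁ r₂ c2)
      from-E₂₁ : 1# ≈ A r₂ r₂ * B c1 c1 - A r₃ r₂ * B c1 c1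
      from-E₂₁ = trans (sym one-minus-zero) (unit-row-difference r₂ c1 r₂ r₃ c1)
      1≈0 : 1# ≈ 0#
      1≈0 = begin
        1#                                    ≈⟨ *-identityʳ 1# ⟨
        1# * 1#                               ≈⟨ *-cong from-E₁₂ from-E₂₁ ⟩
        (x * b₂ - x′ * b₂) * (y * b₁ - y′ * b₁) ≈⟨ swap x x′ y y′ b₁ b₂ ⟩
        (x * b₁ - x′ * b₁) * (y * b₂ - y′ * b₂) ≈⟨ *-congʳ from-E₁₁ ⟨
        0# * (y * b₂ - y′ * b₂)               ≈⟨ zeroˡ _ ⟩
        0#                                    ∎
        where
        x x′ y y′ b₁ b₂ : Carrier
        x = A r₁ r₁; x′ = A r₂ r₁; y = A r₂ r₂; y′ = A r₃ r₂; b₁ = B c1 c1; b₂ = B c2 c2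
        swap : ∀ x x′ y y′ b₁ b₂ →
               (x * b₂ - x′ * b₂) * (y * b₁ - y′ * b₁) ≈ (x * b₁ - x′ * b₁) * (y * b₂ - y′ * b₂)
        swap = solve 6 (λ x x′ y y′ b₁ b₂ → (x :* b₂ :- x′ :* b₂) :* (y :* b₁ :- y′ :* b₁)
                                         := (x :* b₁ :- x′ :* b₁) :* (y :* b₂ :- y′ :* b₂)) refl

  sgn-even : ∀ k → sgn (k ℕ.* 2) ≈ 1#
  sgn-even zero    = refl
  sgn-even (suc k) = trans (-‿involutive _) (sgn-even k)

lemma24 : ∀ {c ℓ : Level} (F : Field c ℓ) (n : ℕ) → 4 ≤ n → 2 ∣ n →
    let open Field F
        open FieldDefs F
    in (∀ (X : Mat n 2) → det₂ (T′ X) ≈ det₂ X)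
       × ¬ (∃ λ (A : Mat n n) → ∃ λ (B : Mat 2 2) → ∃ λ (φ : Mat n 2 → Mat n 2) →
              IsLinear φ × (∀ X → RowsEqual (φ X)) × (∀ X → T′ X ≋ (((A ⊗ X) ⊗ B) ⊕ φ X)))
lemma24 F .(0 ℕ.* 2) ()                (divides zero ≡.refl)
lemma24 F .(1 ℕ.* 2) (s≤s (s≤s ()))    (divides (suc zero) ≡.refl)
lemma24 F .(suc (suc k) ℕ.* 2) _       (divides (suc (suc k)) ≡.refl) =
  Even.det₂-T′ (2 ℕ.+ k ℕ.* 2) (sgn-even (suc k)) ,
  NonStandard.T′-not-standard (k ℕ.* 2) (sgn-even (suc k))
  where open CullisForm F
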